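{- Let $\mathcal{G}=(V,E,\tau)$ be an edge periodic graph with $n=|V|$. If $\mathcal{G}$ is cop-winning, then the robber can be caught within $n^2\cdot \mathrm{LCM}(L_{\mathcal{G}})$ rounds.
   Context: An edge periodic graph $\mathcal{G}=(V,E,\tau)$ consists of a finite graph $G=(V,E)$ and a function $\tau: E\to\{0,1\}^*$ such that edge $e$ exists in time step $t\ge 0$ if and only if $\tau(e)[t \bmod |\tau(e)|]=1$; every edge exists in at least one time step. $L_{\mathcal{G}}=\{|\tau(e)| : e\in E\}$ and $\mathrm{LCM}(L_{\mathcal{G}})$ is its least common multiple. The one-cop game: first the cop chooses a start vertex, then the robber; then in each time step (round) $t=0,1,2,\dots$, first the cop and then the robber either stays or moves along an edge present at time $t$. The cop catches the robber if after the cop's move in some time step both are on the same vertex. $\mathcal{G}$ is cop-winning if the cop has a strategy (including start vertex) catching the robber regardless of the robber's start vertex and moves. -}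

module Defs where

open import Data.Nat using (ℕ; zero; suc; _<_; _*_; _^_; _%_)
open import Data.Nat.DivMod using (m%n<n)
open import Data.Nat.LCM using (lcm)
open import Data.Bool using (Bool; true; false)
open import Data.Fin using (Fin; fromℕ<)
open import Data.List as List using (List; []; _∷_; length; foldr; map; concatMap; allFin)
open import Data.List.Membership.Propositional using (_∈_)
open import Data.Maybe using (Maybe; just; nothing)
open import Data.Vec using (Vec; []; _∷_; head)
open import Data.Product using (Σ; _×_; _,_; ∃)
open import Data.Sum using (_⊎_)
open import Relation.Binary.PropositionalEquality using (_≡_; _≢_)

-- periodic reading of a bit pattern: s[t mod |s|] (false for the empty pattern,
-- which is excluded by the well-formedness conditions below)
bitAt : List Bool → ℕ → Bool
bitAt []       t = false
bitAt (b ∷ bs) t = List.lookup (b ∷ bs) (fromℕ< (m%n<n t (suc (length bs))))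

-- An edge periodic graph on the vertex set Fin n.
-- τ u v = nothing : {u,v} is not an edge of the underlying graph G;
-- τ u v = just s  : {u,v} ∈ E with τ({u,v}) = s.
record EdgePeriodicGraph (n : ℕ) : Set where
  field
    τ        : Fin n → Fin n → Maybe (List Bool)
    sym      : ∀ u v → τ u v ≡ τ v u
    loopless : ∀ v → τ v v ≡ nothing
    nonempty : ∀ u v s → τ u v ≡ just s → 0 < length s
    someTime : ∀ u v s → τ u v ≡ just s → true ∈ s

open EdgePeriodicGraph public

EdgeAt : ∀ {n} → EdgePeriodicGraph n → ℕ → Fin n → Fin n → Set
EdgeAt G t u v = Σ (List Bool) λ s → (τ G u v ≡ just s) × (bitAt s t ≡ true)

Move : ∀ {n} → EdgePeriodicGraph n → ℕ → Fin n → Fin n → Set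
Move G t u v = (u ≡ v) ⊎ EdgeAt G t u v

-- L_G as a list (with repetitions, irrelevant for the LCM) and LCM(L_G)
periodLengths : ∀ {n} → EdgePeriodicGraph n → List ℕ
periodLengths {n} G =
  concatMap (λ u → concatMap (λ v → lengthOf (τ G u v)) (allFin n)) (allFin n)
  where
  lengthOf : Maybe (List Bool) → List ℕ
  lengthOf nothing  = []
  lengthOf (just s) = length s ∷ []

LCM : ∀ {n} → EdgePeriodicGraph n → ℕ
LCM G = foldr lcm 1 (periodLengths G)

-- A (deterministic, full-information) cop strategy: a start vertex and, for
-- each time step t, the cop's new position as a function of the history of
-- cop positions and robber positions at the start of rounds t, t-1, …, 0
-- (most recent first).
record CopStrategy {n} (G : EdgePeriodicGraph n) : Set where
  field
    start : Fin n
    next  : (t : ℕ) → Vec (Fin n) (suc t) → Vec (Fin n) (suc t) → Fin n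
    legal : ∀ t hc hr → Move G t (head hc) (next t hc hr)

open CopStrategy public

-- a robber play: r t = robber position at the start of round t
-- (r 0 is the robber's start vertex), all moves legal
RobberPlay : ∀ {n} → EdgePeriodicGraph n → (ℕ → Fin n) → Set
RobberPlay G r = ∀ t → Move G t (r t) (r (suc t))

robHist : ∀ {n} → (ℕ → Fin n) → (t : ℕ) → Vec (Fin n) (suc t)
robHist r zero    = r zero ∷ []
robHist r (suc t) = r (suc t) ∷ robHist r t

copHist : ∀ {n} {G : EdgePeriodicGraph n} → CopStrategy G → (ℕ → Fin n) →
          (t : ℕ) → Vec (Fin n) (suc t)
copHist σ r zero    = start σ ∷ []
copHist σ r (suc t) = next σ t (copHist σ r t) (robHist r t) ∷ copHist σ r t

-- the cop catches the robber in time step t: after the cop's move in round t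
-- both are on the same vertex
CaughtAt : ∀ {n} {G : EdgePeriodicGraph n} → CopStrategy G → (ℕ → Fin n) → ℕ → Set
CaughtAt σ r t = head (copHist σ r (suc t)) ≡ r t

CopWinning : ∀ {n} → EdgePeriodicGraph n → Set
CopWinning G = Σ (CopStrategy G) λ σ →
  ∀ r → RobberPlay G r → ∃ λ t → CaughtAt σ r t

CatchWithin : ∀ {n} → EdgePeriodicGraph n → ℕ → Set
CatchWithin G N = Σ (CopStrategy G) λ σ →
  ∀ r → RobberPlay G r → ∃ λ t → (t < N) × CaughtAt σ r t

-- Call a position (time t, cop on c about to move, robber on r) k-catchable if the cop can force
-- a capture within k rounds.  Legality of a move at time t depends only on t mod LCM, so the
-- k-catchable positions form a subset of the n·n·LCM positions (c, r, t mod LCM), increasing in k.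
-- Such a chain stalls within n·n·LCM steps, and a single stalled step makes it constant from then
-- on.  If some robber start were not (n²·LCM)-catchable from the start vertex of a winning
-- strategy, the robber could stay outside this fixed point forever; otherwise playing a catching
-- move with budget n²·LCM − t in round t catches the robber within n²·LCM rounds.

module Submission where

open import Defs hiding (sym)
open import Data.Nat using (ℕ; zero; suc; pred; _+_; _*_; _^_; _∸_; _<_; _≤_; _%_; NonZero; z≤n; s≤s)
open import Data.Nat using (_≤′_; ≤′-refl; ≤′-step; >-nonZero)
open import Data.Nat.Properties
open import Data.Nat.DivMod using (m%n<n; m%n%n≡m%n; %-distribˡ-+; m∣n⇒o%n%m≡o%m)
open import Data.Nat.LCM using (lcm; gcd*lcm; m∣lcm[m,n]; n∣lcm[m,n])
open import Data.Nat.GCD using (gcd)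
open import Data.Nat.Divisibility using (_∣_; ∣-trans)
open import Data.Bool as Bool using (true)
open import Data.Fin using (Fin; toℕ; fromℕ<; combine; remQuot) renaming (_≟_ to _≟ᶠ_)
open import Data.Fin.Properties using (fromℕ<-cong; toℕ-fromℕ<; remQuot-combine; any?; all?; ¬∀⟶∃¬)
open import Data.Fin.Subset using (Subset; _∈_; _⊆_; _⊂_; ∣_∣)
open import Data.Fin.Subset.Properties using (_∈?_; _⊂?_; p⊂q⇒∣p∣<∣q∣; ∣p∣≤n)
open import Data.List as List using ([]; _∷_; foldr; length; allFin)
open import Data.List.Relation.Unary.All as All using (All; []; _∷_)
open import Data.List.Relation.Unary.Any using (here; there; satisfied)
open import Data.List.Membership.Propositional using (lose) renaming (_∈_ to _∈ₗ_)
open import Data.List.Membership.Propositional.Properties using (∈-concatMap⁺; ∈-concatMap⁻; ∈-allFin)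
open import Data.Maybe using (just; nothing)
open import Data.Vec using (Vec; _∷_; []; head; tabulate)
open import Data.Vec.Properties using (lookup∘tabulate; []=⇒lookup; lookup⇒[]=)
open import Data.Product using (∃; _×_; _,_; proj₁; proj₂; map₁)
open import Data.Sum using (_⊎_; inj₁; inj₂)
open import Data.Empty using (⊥; ⊥-elim)
open import Function using (_∘_; const)
open import Level using (Level)
open import Relation.Unary using (Pred; Decidable)
open import Relation.Nullary using (¬_; Dec; yes; no; does; contradiction)
open import Relation.Nullary.Decidable using (dec-true; _×-dec_; _⊎-dec_; _→-dec_)
open import Relation.Binary.PropositionalEquality

private variable
  ℓ : Level
  m : ℕ

lcm-pos : ∀ {a b} → 0 < a → 0 < b → 0 < lcm a b
lcm-pos {a} {b} 0<a 0<b with lcm a b | gcd*lcm a b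
... | suc _ | _         = s≤s z≤n
... | zero  | gcd*0≡a*b =
  contradiction (trans (sym (*-zeroʳ (gcd a b))) gcd*0≡a*b) (<⇒≢ (*-mono-< 0<a 0<b))

foldr-lcm-pos : ∀ {xs} → All (0 <_) xs → 0 < foldr lcm 1 xs
foldr-lcm-pos []           = s≤s z≤n
foldr-lcm-pos (0<x ∷ 0<xs) = lcm-pos 0<x (foldr-lcm-pos 0<xs)

∈⇒∣foldr-lcm : ∀ {x xs} → x ∈ₗ xs → x ∣ foldr lcm 1 xs
∈⇒∣foldr-lcm {xs = y ∷ _} (here refl)  = m∣lcm[m,n] y _
∈⇒∣foldr-lcm {xs = y ∷ _} (there x∈ys) = ∣-trans (∈⇒∣foldr-lcm x∈ys) (n∣lcm[m,n] y _)

suc-%-cong : ∀ {t t′} d .{{_ : NonZero d}} → t % d ≡ t′ % d → suc t % d ≡ suc t′ % d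
suc-%-cong {t} {t′} d t≡t′ = begin
  (1 + t) % d           ≡⟨ %-distribˡ-+ 1 t d ⟩
  (1 % d + t % d) % d   ≡⟨ cong (λ x → (1 % d + x) % d) t≡t′ ⟩
  (1 % d + t′ % d) % d  ≡⟨ %-distribˡ-+ 1 t′ d ⟨
  (1 + t′) % d          ∎
  where open ≡-Reasoning

bitAt-cong : ∀ s {d t t′} .{{_ : NonZero d}} → length s ∣ d → t % d ≡ t′ % d →
             bitAt s t ≡ bitAt s t′
bitAt-cong []          _    _    = refl
bitAt-cong s@(_ ∷ _) {d} {t} {t′} ∣s∣∣d t≡t′ =
  cong (List.lookup s) (fromℕ<-cong _ _ t≡t′[mod∣s∣] _ _)
  where
  open ≡-Reasoning
  t≡t′[mod∣s∣] : t % length s ≡ t′ % length s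
  t≡t′[mod∣s∣] = begin
    t % length s      ≡⟨ m∣n⇒o%n%m≡o%m _ d t ∣s∣∣d ⟨
    t % d % length s  ≡⟨ cong (_% length s) t≡t′ ⟩
    t′ % d % length s ≡⟨ m∣n⇒o%n%m≡o%m _ d t′ ∣s∣∣d ⟩
    t′ % length s     ∎

toSubset : {P : Pred (Fin m) ℓ} → Decidable P → Subset m
toSubset P? = tabulate (does ∘ P?)

∈-toSubset⁺ : ∀ {P : Pred (Fin m) ℓ} (P? : Decidable P) {x} → P x → x ∈ toSubset P?
∈-toSubset⁺ P? {x} px = lookup⇒[]= x _ (trans (lookup∘tabulate _ x) (dec-true (P? x) px))

∈-toSubset⁻ : ∀ {P : Pred (Fin m) ℓ} (P? : Decidable P) {x} → x ∈ toSubset P? → P x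
∈-toSubset⁻ P? {x} x∈P with P? x | trans (sym (lookup∘tabulate _ x)) ([]=⇒lookup x∈P)
... | yes px | _  = px
... | no  _  | ()

⊆∧⊄⇒⊇ : {p q : Subset m} → p ⊆ q → ¬ p ⊂ q → q ⊆ p
⊆∧⊄⇒⊇ {p = p} p⊆q p⊄q {x} x∈q with x ∈? p
... | yes x∈p = x∈p
... | no  x∉p = contradiction ((λ {y} → p⊆q {y}) , x , x∈q , x∉p) p⊄q

module _ (p : ℕ → Subset m) (increasing : ∀ k → p k ⊆ p (suc k)) where

  ⊆-chain-grows-or-stalls : ∀ k → k ≤ ∣ p k ∣ ⊎ ∃ λ j → j < k × p (suc j) ⊆ p j
  ⊆-chain-grows-or-stalls zero = inj₁ z≤n
  ⊆-chain-grows-or-stalls (suc k) with ⊆-chain-grows-or-stalls k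
  ... | inj₂ (j , j<k , stall) = inj₂ (j , m<n⇒m<1+n j<k , stall)
  ... | inj₁ k≤∣pk∣ with p k ⊂? p (suc k)
  ...   | yes pk⊂pk+1 = inj₁ (≤-trans (s≤s k≤∣pk∣) (p⊂q⇒∣p∣<∣q∣ pk⊂pk+1))
  ...   | no  pk⊄pk+1 = inj₂ (k , n<1+n k , ⊆∧⊄⇒⊇ (increasing k) pk⊄pk+1)

  ⊆-chain-stalls : ∃ λ k → k ≤ m × p (suc k) ⊆ p k
  ⊆-chain-stalls with ⊆-chain-grows-or-stalls (suc m)
  ... | inj₁ m<∣p∣              = contradiction (≤-trans m<∣p∣ (∣p∣≤n (p (suc m)))) (n≮n m)
  ... | inj₂ (j , j≤m , stall) = j , ≤-pred j≤m , stall

head-robHist : ∀ {n} (r : ℕ → Fin n) t → head (robHist r t) ≡ r t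
head-robHist r zero    = refl
head-robHist r (suc t) = refl

module _ {n} (G : EdgePeriodicGraph n) where

  mutual
    length∈periodLengths : ∀ {u v s} → τ G u v ≡ just s → length s ∈ₗ periodLengths G
    length∈periodLengths {u} {v} τuv≡s =
      ∈-concatMap⁺ _ (lose (∈-allFin u)
        (∈-concatMap⁺ _ (lose (∈-allFin v) (length∈lengthOf τuv≡s))))

    -- The list function inside `periodLengths` is local to it, so it can only be named by unification.
    length∈lengthOf : ∀ {u v s} → τ G u v ≡ just s → length s ∈ₗ _
    length∈lengthOf {u} {v} τuv≡s with τ G u v
    length∈lengthOf refl | .(just _) = here refl

  periodLength-pos : ∀ {x} → x ∈ₗ periodLengths G → 0 < x
  periodLength-pos x∈ with u , x∈u ← satisfied (∈-concatMap⁻ _ {xs = allFin n} x∈)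
                      with v , x∈uv ← satisfied (∈-concatMap⁻ _ {xs = allFin n} x∈u)
                      with τ G u v in τuv≡
  ... | just s with here refl ← x∈uv = nonempty G u v s τuv≡

  LCM-pos : 0 < LCM G
  LCM-pos = foldr-lcm-pos (All.tabulate periodLength-pos)

  instance
    LCM-nonZero : NonZero (LCM G)
    LCM-nonZero = >-nonZero LCM-pos

  length∣LCM : ∀ {u v s} → τ G u v ≡ just s → length s ∣ LCM G
  length∣LCM = ∈⇒∣foldr-lcm ∘ length∈periodLengths

  _≡_mod-LCM : ℕ → ℕ → Set
  t ≡ t′ mod-LCM = t % LCM G ≡ t′ % LCM G

  Move-cong : ∀ {t t′ u v} → t ≡ t′ mod-LCM → Move G t u v → Move G t′ u v
  Move-cong t≡t′ (inj₁ u≡v)              = inj₁ u≡v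
  Move-cong t≡t′ (inj₂ (s , τuv≡s , on)) =
    inj₂ (s , τuv≡s , trans (sym (bitAt-cong s (length∣LCM τuv≡s) t≡t′)) on)

  EdgeAt? : ∀ t u v → Dec (EdgeAt G t u v)
  EdgeAt? t u v with τ G u v
  ... | nothing = no λ ()
  ... | just s with bitAt s t Bool.≟ true
  ...   | yes on  = yes (s , refl , on)
  ...   | no  off = no λ { (_ , refl , on) → off on }

  Move? : ∀ t u v → Dec (Move G t u v)
  Move? t u v = (u ≟ᶠ v) ⊎-dec EdgeAt? t u v

  Catchable : ℕ → ℕ → Fin n → Fin n → Set
  Catchable zero    t c r = ⊥
  Catchable (suc k) t c r =
    ∃ λ c′ → Move G t c c′ × (c′ ≡ r ⊎ ∀ r′ → Move G t r r′ → Catchable k (suc t) c′ r′)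

  Catchable? : ∀ k t c r → Dec (Catchable k t c r)
  Catchable? zero    t c r = no λ ()
  Catchable? (suc k) t c r =
    any? λ c′ → Move? t c c′ ×-dec
      ((c′ ≟ᶠ r) ⊎-dec all? λ r′ → Move? t r r′ →-dec Catchable? k (suc t) c′ r′)

  Catchable-suc : ∀ {k t c r} → Catchable k t c r → Catchable (suc k) t c r
  Catchable-suc {suc k} (c′ , move , inj₁ caught) = c′ , move , inj₁ caught
  Catchable-suc {suc k} (c′ , move , inj₂ wins)   = c′ , move , inj₂ λ r′ → Catchable-suc ∘ wins r′

  Catchable-cong : ∀ {k t t′ c r} → t ≡ t′ mod-LCM → Catchable k t c r → Catchable k t′ c r
  Catchable-cong {suc k} t≡t′ (c′ , move , inj₁ caught) = c′ , Move-cong t≡t′ move , inj₁ caught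
  Catchable-cong {suc k} t≡t′ (c′ , move , inj₂ wins)   =
    c′ , Move-cong t≡t′ move ,
    inj₂ λ r′ move′ →
      Catchable-cong (suc-%-cong (LCM G) t≡t′) (wins r′ (Move-cong (sym t≡t′) move′))

  Stable : ℕ → Set
  Stable k = ∀ {t c r} → Catchable (suc k) t c r → Catchable k t c r

  Stable-suc : ∀ {k} → Stable k → Stable (suc k)
  Stable-suc stable (c′ , move , inj₁ caught) = c′ , move , inj₁ caught
  Stable-suc stable (c′ , move , inj₂ wins)   = c′ , move , inj₂ λ r′ → stable ∘ wins r′

  Stable-≤′ : ∀ {k j} → Stable k → k ≤′ j → Stable j
  Stable-≤′ stable ≤′-refl        = stable
  Stable-≤′ stable (≤′-step k≤′j) = Stable-suc (Stable-≤′ stable k≤′j)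

  Position : Set
  Position = Fin (n * n * LCM G)

  position : ℕ → Fin n → Fin n → Position
  position t c r = combine (combine c r) (fromℕ< (m%n<n t (LCM G)))

  decode : Position → (Fin n × Fin n) × Fin (LCM G)
  decode = map₁ (remQuot n) ∘ remQuot (LCM G)

  decode-position : ∀ t c r → decode (position t c r) ≡ ((c , r) , fromℕ< (m%n<n t (LCM G)))
  decode-position t c r = trans (cong (map₁ (remQuot n)) (remQuot-combine (combine c r) _))
                                (cong (_, _) (remQuot-combine c r))

  CatchableFrom : ℕ → (Fin n × Fin n) × Fin (LCM G) → Set
  CatchableFrom k ((c , r) , i) = Catchable k (toℕ i) c r

  CatchableAt : ℕ → Pred Position _
  CatchableAt k = CatchableFrom k ∘ decode

  CatchableAt? : ∀ k → Decidable (CatchableAt k)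
  CatchableAt? k x = Catchable? k (toℕ (proj₂ (decode x))) _ _

  toℕ-fromℕ<-% : ∀ t → toℕ (fromℕ< (m%n<n t (LCM G))) ≡ t mod-LCM
  toℕ-fromℕ<-% t = trans (cong (_% LCM G) (toℕ-fromℕ< _)) (m%n%n≡m%n t (LCM G))

  Catchable⇒CatchableAt : ∀ {k t c r} → Catchable k t c r → CatchableAt k (position t c r)
  Catchable⇒CatchableAt {k} {t} {c} {r} catchable =
    subst (CatchableFrom k) (sym (decode-position t c r))
      (Catchable-cong (sym (toℕ-fromℕ<-% t)) catchable)

  CatchableAt⇒Catchable : ∀ {k t c r} → CatchableAt k (position t c r) → Catchable k t c r
  CatchableAt⇒Catchable {k} {t} {c} {r} catchable =
    Catchable-cong (toℕ-fromℕ<-% t) (subst (CatchableFrom k) (decode-position t c r) catchable)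

  catchableSet : ℕ → Subset (n * n * LCM G)
  catchableSet k = toSubset (CatchableAt? k)

  catchableSet-increasing : ∀ k → catchableSet k ⊆ catchableSet (suc k)
  catchableSet-increasing k =
    ∈-toSubset⁺ (CatchableAt? (suc k)) ∘ Catchable-suc ∘ ∈-toSubset⁻ (CatchableAt? k)

  Stable-n²LCM : Stable (n ^ 2 * LCM G)
  Stable-n²LCM with k , k≤n*n*L , stall ← ⊆-chain-stalls catchableSet catchableSet-increasing =
    Stable-≤′ stable (≤⇒≤′ (subst (k ≤_) n*n≡n^2 k≤n*n*L))
    where
    n*n≡n^2 : n * n * LCM G ≡ n ^ 2 * LCM G
    n*n≡n^2 = cong (λ x → n * x * LCM G) (sym (*-identityʳ n))
    stable : Stable k
    stable catchable =
      CatchableAt⇒Catchable (∈-toSubset⁻ (CatchableAt? k)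
        (stall (∈-toSubset⁺ (CatchableAt? (suc k)) (Catchable⇒CatchableAt catchable))))

  evade : ∀ {k t c r c′} → Stable k → ¬ Catchable k t c r → Move G t c c′ →
          c′ ≢ r × ∃ λ r′ → Move G t r r′ × ¬ Catchable k (suc t) c′ r′
  evade {k} {t} {c} {r} {c′} stable uncatchable move =
    (λ caught → uncatchable (stable (c′ , move , inj₁ caught))) , escape
    where
    escape : ∃ λ r′ → Move G t r r′ × ¬ Catchable k (suc t) c′ r′
    escape with r′ , ¬wins ← ¬∀⟶∃¬ n _ (λ r′ → Move? t r r′ →-dec Catchable? k (suc t) c′ r′)
                                      (λ wins → uncatchable (stable (c′ , move , inj₂ wins)))
                with Move? t r r′
    ... | yes move′ = r′ , move′ , ¬wins ∘ const
    ... | no ¬move′ = contradiction (λ move′ → contradiction move′ ¬move′) ¬wins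

  module Evasion (σ : CopStrategy G) {k} (stable : Stable k)
                 (r₀ : Fin n) (safe₀ : ¬ Catchable k 0 (start σ) r₀) where

    record Round (t : ℕ) : Set where
      constructor round
      field
        cops robbers : Vec (Fin n) (suc t)
        safe         : ¬ Catchable k t (head cops) (head robbers)
    open Round

    copMove : ∀ {t} → Round t → Fin n
    copMove {t} ρ = next σ t (cops ρ) (robbers ρ)

    robberMove : ∀ {t} (ρ : Round t) →
                 copMove ρ ≢ head (robbers ρ) ×
                 ∃ λ r′ → Move G t (head (robbers ρ)) r′ × ¬ Catchable k (suc t) (copMove ρ) r′
    robberMove {t} ρ = evade stable (safe ρ) (legal σ t (cops ρ) (robbers ρ))

    rounds : ∀ t → Round t
    rounds zero    = round (start σ ∷ []) (r₀ ∷ []) safe₀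
    rounds (suc t) with _ , r′ , _ , safe′ ← robberMove (rounds t) =
      round (copMove (rounds t) ∷ cops (rounds t)) (r′ ∷ robbers (rounds t)) safe′

    robber : ℕ → Fin n
    robber t = head (robbers (rounds t))

    robber-legal : RobberPlay G robber
    robber-legal t = proj₁ (proj₂ (proj₂ (robberMove (rounds t))))

    robHist-robber : ∀ t → robHist robber t ≡ robbers (rounds t)
    robHist-robber zero    = refl
    robHist-robber (suc t) = cong (robber (suc t) ∷_) (robHist-robber t)

    copHist-robber : ∀ t → copHist σ robber t ≡ cops (rounds t)
    copHist-robber zero    = refl
    copHist-robber (suc t) =
      cong₂ (λ cs rs → next σ t cs rs ∷ cs) (copHist-robber t) (robHist-robber t)

    robber-evades : ∀ t → ¬ CaughtAt σ robber t
    robber-evades t caught = proj₁ (robberMove (rounds t))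
      (subst (_≡ robber t) (cong₂ (next σ t) (copHist-robber t) (robHist-robber t)) caught)

    strategy-loses : ¬ (∀ r → RobberPlay G r → ∃ λ t → CaughtAt σ r t)
    strategy-loses wins with t , caught ← wins robber robber-legal = robber-evades t caught

  winning⇒start-Catchable : ∀ {k} → Stable k → (σ : CopStrategy G) →
                            (∀ r → RobberPlay G r → ∃ λ t → CaughtAt σ r t) →
                            ∀ r₀ → Catchable k 0 (start σ) r₀
  winning⇒start-Catchable {k} stable σ wins r₀ with Catchable? k 0 (start σ) r₀
  ... | yes catchable = catchable
  ... | no  safe₀ = contradiction wins (Evasion.strategy-loses σ stable r₀ safe₀)

  catchingMove : ∀ k t c r →
    ∃ λ c′ → Move G t c c′ ×
             (Catchable k t c r → c′ ≡ r ⊎ ∀ r′ → Move G t r r′ → Catchable (pred k) (suc t) c′ r′)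
  catchingMove zero    t c r = c , inj₁ refl , λ ()
  catchingMove (suc k) t c r with Catchable? (suc k) t c r
  ... | yes (c′ , move , closes) = c′ , move , const closes
  ... | no  uncatchable          = c , inj₁ refl , λ catchable → contradiction catchable uncatchable

  module Greedy (N : ℕ) (c₀ : Fin n) where

    greedy : CopStrategy G
    greedy = record
      { start = c₀
      ; next  = λ t cops robbers → proj₁ (catchingMove (N ∸ t) t (head cops) (head robbers))
      ; legal = λ t cops robbers → proj₁ (proj₂ (catchingMove (N ∸ t) t (head cops) (head robbers)))
      }

    module _ (c₀-catches : ∀ r₀ → Catchable N 0 c₀ r₀) (r : ℕ → Fin n) (r-legal : RobberPlay G r) where

      cop : ℕ → Fin n
      cop t = head (copHist greedy r t)

      CaughtBefore : ℕ → Set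
      CaughtBefore t = ∃ λ t′ → t′ < t × CaughtAt greedy r t′

      greedy-step : ∀ t → Catchable (N ∸ t) t (cop t) (r t) →
                    CaughtAt greedy r t ⊎ Catchable (N ∸ suc t) (suc t) (cop (suc t)) (r (suc t))
      greedy-step t catchable with head (robHist r t) | head-robHist r t
      ... | _ | refl with proj₂ (proj₂ (catchingMove (N ∸ t) t (cop t) (r t))) catchable
      ...   | inj₁ caught = inj₁ caught
      ...   | inj₂ wins   =
              inj₂ (subst (λ k → Catchable k (suc t) c′ (r (suc t))) (pred[m∸n]≡m∸[1+n] N t)
                      (wins (r (suc t)) (r-legal t)))
        where c′ = proj₁ (catchingMove (N ∸ t) t (cop t) (r t))

      caught-or-catchable : ∀ t → CaughtBefore t ⊎ Catchable (N ∸ t) t (cop t) (r t)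
      caught-or-catchable zero = inj₂ (c₀-catches (r 0))
      caught-or-catchable (suc t) with caught-or-catchable t
      ... | inj₁ (t′ , t′<t , caught) = inj₁ (t′ , m<n⇒m<1+n t′<t , caught)
      ... | inj₂ catchable with greedy-step t catchable
      ...   | inj₁ caught     = inj₁ (t , n<1+n t , caught)
      ...   | inj₂ catchable′ = inj₂ catchable′

      greedy-catches : CaughtBefore N
      greedy-catches with caught-or-catchable N
      ... | inj₁ caught    = caught
      ... | inj₂ catchable = ⊥-elim (subst (λ k → Catchable k N (cop N) (r N)) (n∸n≡0 N) catchable)

  Catchable⇒CatchWithin : ∀ N c₀ → (∀ r₀ → Catchable N 0 c₀ r₀) → CatchWithin G N
  Catchable⇒CatchWithin N c₀ c₀-catches = greedy , greedy-catches c₀-catches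
    where open Greedy N c₀

lemma3 : (n : ℕ) (G : EdgePeriodicGraph n) →
    CopWinning G → CatchWithin G (n ^ 2 * LCM G)
lemma3 n G (σ , wins) =
  Catchable⇒CatchWithin G (n ^ 2 * LCM G) (start σ)
    (winning⇒start-Catchable G (Stable-n²LCM G) σ wins)
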